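{- Let $G$ be a tree-path intersection graph with the rooting and order $\le$ described in the context. If $\min\Gamma(s_1)<\min\Gamma(s_2)$, then any two elements of $\Gamma(s_1)\cap\Gamma(s_2)$ are comparable.
   Context: A tree-path intersection graph is a connected bipartite graph $G$ with disjoint parts $G_H$, $G_V$, together with a tree $T_H$ on vertex set $G_H$ and a tree $T_V$ on vertex set $G_V$, such that for every $h\in G_H$ the neighbourhood $\Gamma(h)$ of $h$ in $G$ is the vertex set of a path in $T_V$, and for every $v\in G_V$ the neighbourhood $\Gamma(v)$ is the vertex set of a path in $T_H$. Fix an edge $h_{\mathrm{root}}v_{\mathrm{root}}\in E(G)$ such that $v_{\mathrm{root}}$ is a leaf of $T_V$; root $T_H$ at $h_{\mathrm{root}}$ and $T_V$ at $v_{\mathrm{root}}$. For $s_1,s_2$ both in $G_H$ (resp. both in $G_V$), $s_1\le s_2$ iff $s_1$ lies on the path of $T_H$ (resp. $T_V$) from the root to $s_2$; vertices from different sides are incomparable; $s_1<s_2$ means $s_1\le s_2$ and $s_1\ne s_2$; $s_1,s_2$ are comparable if $s_1\le s_2$ or $s_2\le s_1$. $\min\Gamma(s)$ denotes the unique $\le$-minimal element of $\Gamma(s)$ (it exists since $\Gamma(s)$ is a path in a rooted tree). -}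

module Defs where

open import Data.Nat using (ℕ)
open import Data.Fin using (Fin)
open import Data.Sum using (_⊎_; inj₁; inj₂)
open import Data.Product using (Σ; ∃; _×_; _,_)
open import Data.List using (List; []; _∷_)
open import Data.List.Membership.Propositional using (_∈_)
open import Data.List.Relation.Unary.Unique.Propositional using (Unique)
open import Data.Empty using (⊥)
open import Relation.Binary.PropositionalEquality using (_≡_)
open import Relation.Nullary using (¬_)
open import Function.Bundles using (_⇔_)

data Walk {V : Set} (A : V → V → Set) : V → V → List V → Set where
  here : ∀ {x} → Walk A x x (x ∷ [])
  step : ∀ {x z y p} → A x z → Walk A z y p → Walk A x y (x ∷ p)

IsPath : {V : Set} → (V → V → Set) → V → V → List V → Set
IsPath A x y p = Walk A x y p × Unique p

record IsTree {V : Set} (A : V → V → Set) : Set where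
  field
    sym     : ∀ {x y} → A x y → A y x
    irrefl  : ∀ {x} → ¬ A x x
    path    : ∀ x y → ∃ λ p → IsPath A x y p
    unique  : ∀ {x y p q} → IsPath A x y p → IsPath A x y q → p ≡ q

IsPathVertexSet : {V : Set} → (V → V → Set) → (V → Set) → Set
IsPathVertexSet A S = ∃ λ x → ∃ λ y → ∃ λ p → IsPath A x y p × (∀ v → (S v ⇔ (v ∈ p)))

-- Vertices of G: G_H = Fin m, G_V = Fin n (disjoint union).
Vtx : ℕ → ℕ → Set
Vtx m n = Fin m ⊎ Fin n

BipAdj : ∀ {m n} → (Fin m → Fin n → Set) → Vtx m n → Vtx m n → Set
BipAdj E (inj₁ h) (inj₂ v) = E h v
BipAdj E (inj₂ v) (inj₁ h) = E h v
BipAdj E (inj₁ _) (inj₁ _) = ⊥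
BipAdj E (inj₂ _) (inj₂ _) = ⊥

record TreePathIntersectionGraph (m n : ℕ) : Set₁ where
  field
    E         : Fin m → Fin n → Set
    TH        : Fin m → Fin m → Set
    TV        : Fin n → Fin n → Set
    connected : ∀ x y → ∃ λ p → Walk (BipAdj E) x y p
    TH-tree   : IsTree TH
    TV-tree   : IsTree TV
    H-path    : ∀ h → IsPathVertexSet TV (λ v → E h v)
    V-path    : ∀ v → IsPathVertexSet TH (λ h → E h v)

  Γ : Vtx m n → Vtx m n → Set
  Γ s t = BipAdj E s t

IsLeaf : {V : Set} → (V → V → Set) → V → Set
IsLeaf A v = ∀ {a b} → A v a → A v b → a ≡ b

TreeLe : {V : Set} → (V → V → Set) → V → V → V → Set
TreeLe A r a b = ∃ λ p → IsPath A r b p × a ∈ p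

Le : ∀ {m n} → TreePathIntersectionGraph m n → Fin m → Fin n →
     Vtx m n → Vtx m n → Set
Le G hr vr (inj₁ a) (inj₁ b) = TreeLe (TreePathIntersectionGraph.TH G) hr a b
Le G hr vr (inj₂ a) (inj₂ b) = TreeLe (TreePathIntersectionGraph.TV G) vr a b
Le G hr vr (inj₁ _) (inj₂ _) = ⊥
Le G hr vr (inj₂ _) (inj₁ _) = ⊥

Lt : ∀ {m n} → TreePathIntersectionGraph m n → Fin m → Fin n →
     Vtx m n → Vtx m n → Set
Lt G hr vr a b = Le G hr vr a b × ¬ (a ≡ b)

Comparable : ∀ {m n} → TreePathIntersectionGraph m n → Fin m → Fin n →
             Vtx m n → Vtx m n → Set
Comparable G hr vr a b = Le G hr vr a b ⊎ Le G hr vr b a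

IsMinimal : ∀ {m n} → TreePathIntersectionGraph m n → Fin m → Fin n →
            (Vtx m n → Set) → Vtx m n → Set
IsMinimal G hr vr S x = S x × (∀ y → S y → ¬ Lt G hr vr y x)

-- If x and y lie on both paths Γ(s₁) and Γ(s₂), the tree path from x to y is a
-- subpath of both. The vertex μ₁ = min Γ(s₁) cannot lie on it, since μ₁ < μ₂ would
-- then contradict the minimality of μ₂ in Γ(s₂). Hence, within the path Γ(s₁),
-- one of x, y lies between μ₁ and the other, say x between μ₁ and y. By minimality
-- of μ₁ the root path to μ₁ meets Γ(s₁) only in μ₁, so it extends through x to y,
-- which gives x ≤ y.
module Submission where

open import Defs
open import Data.Empty using (⊥-elim)
open import Data.Fin using (Fin)
open import Data.List using (List; []; _∷_; _++_; [_]; reverse)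
open import Data.List.Properties using (unfold-reverse)
open import Data.List.Membership.Propositional using (_∈_)
open import Data.List.Membership.Propositional.Properties using (∈-++⁺ˡ; ∈-++⁻)
open import Data.List.Relation.Unary.Any using (here; there)
open import Data.List.Relation.Unary.Any.Properties using (reverse⁺; reverse⁻)
open import Data.List.Relation.Unary.All using ([])
import Data.List.Relation.Unary.All as All
open import Data.List.Relation.Unary.All.Properties using (anti-mono)
open import Data.List.Relation.Unary.AllPairs using ([]; _∷_)
open import Data.List.Relation.Unary.Unique.Propositional using (Unique)
import Data.List.Relation.Unary.Unique.Propositional.Properties as Unique
open import Data.List.Relation.Binary.Disjoint.Propositional using (Disjoint)
open import Data.List.Relation.Binary.Subset.Propositional using (_⊆_)
open import Data.List.Relation.Binary.Subset.Propositional.Properties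
  using (∈-∷⁺ʳ; xs⊆x∷xs; xs⊆xs++ys; xs⊆ys++xs; ++⁺ʳ)
open import Data.List.Relation.Binary.Permutation.Propositional using (↭-sym; ↭⇒↭ₛ)
open import Data.List.Relation.Binary.Permutation.Propositional.Properties using (↭-reverse)
import Data.List.Relation.Binary.Permutation.Setoid.Properties as PermutationSetoid
open import Data.Product using (∃; _×_; _,_; proj₁; proj₂)
open import Data.Sum using (_⊎_; inj₁; inj₂)
import Data.Sum as Sum
open import Data.Sum.Properties using (inj₁-injective; inj₂-injective)
open import Function using (_∘_; id)
open import Function.Bundles using (module Equivalence)
open Equivalence using (to; from)
open import Relation.Binary.PropositionalEquality
  using (_≡_; _≢_; refl; sym; subst; cong; setoid)
open import Relation.Nullary using (¬_)

module _ {X : Set} where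

  private
    variable
      x y : X
      xs : List X

  prefix : x ∈ xs → List X
  prefix {xs = z ∷ _} (here _) = [ z ]
  prefix {xs = z ∷ _} (there m) = z ∷ prefix m

  suffix : x ∈ xs → List X
  suffix {xs = xs} (here _) = xs
  suffix (there m) = suffix m

  prefix⊆ : (m : x ∈ xs) → prefix m ⊆ xs
  prefix⊆ (here _) (here e) = here e
  prefix⊆ (there m) (here e) = here e
  prefix⊆ (there m) (there n) = there (prefix⊆ m n)

  suffix⊆ : (m : x ∈ xs) → suffix m ⊆ xs
  suffix⊆ (here _) n = n
  suffix⊆ (there m) n = there (suffix⊆ m n)

  ∈-prefix⊎suffix : (m : x ∈ xs) → y ∈ xs → y ∈ prefix m ⊎ y ∈ suffix m
  ∈-prefix⊎suffix (here refl) n = inj₂ n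
  ∈-prefix⊎suffix (there m) (here e) = inj₁ (here e)
  ∈-prefix⊎suffix (there m) (there n) = Sum.map there id (∈-prefix⊎suffix m n)

  ∈-prefix∩suffix : Unique xs → (m : x ∈ xs) → y ∈ prefix m → y ∈ suffix m → y ≡ x
  ∈-prefix∩suffix _ (here refl) (here e) _ = e
  ∈-prefix∩suffix (z∉zs ∷ _) (there m) (here refl) n =
    ⊥-elim (All.lookup z∉zs (suffix⊆ m n) refl)
  ∈-prefix∩suffix (_ ∷ u) (there m) (there n) n′ = ∈-prefix∩suffix u m n n′

  prefix-ordered : (m : x ∈ xs) (n : y ∈ xs) → x ∈ prefix n ⊎ y ∈ prefix m
  prefix-ordered (here refl) (here refl) = inj₁ (here refl)
  prefix-ordered (here refl) (there n) = inj₁ (here refl)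
  prefix-ordered (there m) (here refl) = inj₂ (here refl)
  prefix-ordered (there m) (there n) = Sum.map there there (prefix-ordered m n)

  unique-prefix : Unique xs → (m : x ∈ xs) → Unique (prefix m)
  unique-prefix _ (here _) = [] ∷ []
  unique-prefix (z∉zs ∷ u) (there m) = anti-mono (prefix⊆ m) z∉zs ∷ unique-prefix u m

  unique-suffix : Unique xs → (m : x ∈ xs) → Unique (suffix m)
  unique-suffix u (here _) = u
  unique-suffix (_ ∷ u) (there m) = unique-suffix u m

  xs++ys⊆zs : ∀ {ys zs : List X} → xs ⊆ zs → ys ⊆ zs → xs ++ ys ⊆ zs
  xs++ys⊆zs {xs = xs} xs⊆zs ys⊆zs = Sum.[ xs⊆zs , ys⊆zs ] ∘ ∈-++⁻ xs

  unique-reverse : Unique xs → Unique (reverse xs)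
  unique-reverse {xs = xs} =
    PermutationSetoid.Unique-resp-↭ (setoid _) (↭⇒↭ₛ (↭-sym (↭-reverse xs)))

module Paths {V : Set} {A : V → V → Set} (A-sym : ∀ {x y} → A x y → A y x) where

  Subpath : List V → V → V → List V → Set
  Subpath p x y q = IsPath A x y q × q ⊆ p

  SubpathVia : List V → V → V → V → Set
  SubpathVia p x a y = ∃ λ q → Subpath p x y q × a ∈ q

  walk-head : ∀ {x y p} → Walk A x y p → x ∈ p
  walk-head here = here refl
  walk-head (step _ _) = here refl

  walk-last : ∀ {x y p} → Walk A x y p → y ∈ p
  walk-last here = here refl
  walk-last (step _ w) = there (walk-last w)

  walk-++ : ∀ {x a y q t} → Walk A x a q → Walk A a y (a ∷ t) → Walk A x y (q ++ t)
  walk-++ here w = w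
  walk-++ (step e v) w = step e (walk-++ v w)

  walk-reverse : ∀ {x y p} → Walk A x y p → Walk A y x (reverse p)
  walk-reverse here = here
  walk-reverse (step {x = x} {p = p} e w) =
    subst (Walk A _ x) (sym (unfold-reverse x p)) (walk-++ (walk-reverse w) (step (A-sym e) here))

  walk-prefix : ∀ {u w x p} → Walk A u w p → (m : x ∈ p) → Walk A u x (prefix m)
  walk-prefix here (here refl) = here
  walk-prefix (step _ _) (here refl) = here
  walk-prefix (step e w) (there m) = step e (walk-prefix w m)

  walk-suffix : ∀ {u w x p} → Walk A u w p → (m : x ∈ p) → Walk A x w (suffix m)
  walk-suffix here (here refl) = here
  walk-suffix (step e w) (here refl) = step e w
  walk-suffix (step _ w) (there m) = walk-suffix w m

  path-++ : ∀ {x a y q t} → IsPath A x a q → IsPath A a y (a ∷ t) → Disjoint q t →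
            IsPath A x y (q ++ t)
  path-++ (w , u) (w′ , _ ∷ u′) q∩t = walk-++ w w′ , Unique.++⁺ u u′ q∩t

  path-reverse : ∀ {x y p} → IsPath A x y p → IsPath A y x (reverse p)
  path-reverse (w , u) = walk-reverse w , unique-reverse u

  path-prefix : ∀ {u w x p} → IsPath A u w p → (m : x ∈ p) → IsPath A u x (prefix m)
  path-prefix (w , u) m = walk-prefix w m , unique-prefix u m

  path-suffix : ∀ {u w x p} → IsPath A u w p → (m : x ∈ p) → IsPath A x w (suffix m)
  path-suffix (w , u) m = walk-suffix w m , unique-suffix u m

  -- The hypothesis reads ¬ c ≢ a rather than c ≡ a so that minimality implies it
  -- without decidable equality.
  path-glue : ∀ {x a y q₁ q₂} → IsPath A x a q₁ → IsPath A a y q₂ →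
              (∀ {c} → c ∈ q₁ → c ∈ q₂ → ¬ c ≢ a) →
              ∃ λ q → IsPath A x y q × q₂ ⊆ q × q ⊆ q₁ ++ q₂
  path-glue {q₁ = q₁} P₁ (here , _) _ =
    q₁ , P₁ , ∈-∷⁺ʳ (walk-last (proj₁ P₁)) (λ ()) , xs⊆xs++ys q₁ _
  path-glue {a = a} {q₁ = q₁} P₁ (step {p = t} e w , a∉t ∷ u) meet =
    q₁ ++ t , path-++ P₁ (step e w , a∉t ∷ u) q₁∩t ,
    ∈-∷⁺ʳ (∈-++⁺ˡ (walk-last (proj₁ P₁))) (xs⊆ys++xs t q₁) , ++⁺ʳ q₁ (xs⊆x∷xs t a)
    where
    q₁∩t : Disjoint q₁ t
    q₁∩t (c∈q₁ , c∈t) = meet c∈q₁ (there c∈t) λ { refl → All.lookup a∉t c∈t refl }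

  prefix-subpath : ∀ {p a z q x} → Subpath p a z q → (m : x ∈ q) → Subpath p a x (prefix m)
  prefix-subpath (Q , q⊆p) m = path-prefix Q m , q⊆p ∘ prefix⊆ m

  backward-ray : ∀ {u w p a} → IsPath A u w p → (m : a ∈ p) → Subpath p a u (reverse (prefix m))
  backward-ray P m = path-reverse (path-prefix P m) , prefix⊆ m ∘ reverse⁻

  forward-ray : ∀ {u w p a} → IsPath A u w p → (m : a ∈ p) → Subpath p a w (suffix m)
  forward-ray P m = path-suffix P m , suffix⊆ m

  subpath : ∀ {u w p x y} → IsPath A u w p → x ∈ p → y ∈ p → ∃ λ q → Subpath p x y q
  subpath P mx my with ∈-prefix⊎suffix mx my
  ... | inj₁ y∈ = _ , prefix-subpath (backward-ray P mx) (reverse⁺ y∈)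
  ... | inj₂ y∈ = _ , prefix-subpath (forward-ray P mx) y∈

  subpaths-from-ordered : ∀ {p a z q x y} → Subpath p a z q → x ∈ q → y ∈ q →
                          SubpathVia p a x y ⊎ SubpathVia p a y x
  subpaths-from-ordered Q mx my = Sum.map (via my) (via mx) (prefix-ordered mx my)
    where
    via : ∀ {v b} (m : b ∈ _) → v ∈ prefix m → SubpathVia _ _ v b
    via m v∈ = prefix m , prefix-subpath Q m , v∈

  subpath-across : ∀ {p a z₁ z₂ q₁ q₂ x y} → Subpath p a z₁ q₁ → Subpath p a z₂ q₂ →
                   (∀ {c} → c ∈ q₁ → c ∈ q₂ → c ≡ a) →
                   x ∈ q₁ → y ∈ q₂ → SubpathVia p x a y
  subpath-across Q₁ Q₂ meet mx my =
    let X , x⊆p = prefix-subpath Q₁ mx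
        Y , y⊆p = prefix-subpath Q₂ my
        q , Q , y⊆q , q⊆ = path-glue (path-reverse X) Y λ c∈₁ c∈₂ c≢a →
                             c≢a (meet (prefix⊆ mx (reverse⁻ c∈₁)) (prefix⊆ my c∈₂))
    in q , (Q , xs++ys⊆zs (x⊆p ∘ reverse⁻) y⊆p ∘ q⊆) , y⊆q (walk-head (proj₁ Y))

  subpath-across-rays : ∀ {u w p a x y} → IsPath A u w p → (m : a ∈ p) →
                        x ∈ reverse (prefix m) → y ∈ suffix m → SubpathVia p x a y
  subpath-across-rays P m = subpath-across (backward-ray P m) (forward-ray P m)
    λ c∈₁ c∈₂ → ∈-prefix∩suffix (proj₂ P) m (reverse⁻ c∈₁) c∈₂

  subpathVia-reverse : ∀ {p x a y} → SubpathVia p x a y → SubpathVia p y a x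
  subpathVia-reverse (q , (Q , q⊆p) , a∈q) =
    reverse q , (path-reverse Q , q⊆p ∘ reverse⁻) , reverse⁺ a∈q

  subpath-between : ∀ {u w p a x y} → IsPath A u w p → a ∈ p → x ∈ p → y ∈ p →
                    SubpathVia p x a y ⊎ SubpathVia p a x y ⊎ SubpathVia p a y x
  subpath-between P ma mx my with ∈-prefix⊎suffix ma mx | ∈-prefix⊎suffix ma my
  ... | inj₁ x∈ | inj₁ y∈ =
    inj₂ (subpaths-from-ordered (backward-ray P ma) (reverse⁺ x∈) (reverse⁺ y∈))
  ... | inj₂ x∈ | inj₂ y∈ = inj₂ (subpaths-from-ordered (forward-ray P ma) x∈ y∈)
  ... | inj₁ x∈ | inj₂ y∈ = inj₁ (subpath-across-rays P ma (reverse⁺ x∈) y∈)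
  ... | inj₂ x∈ | inj₁ y∈ = inj₁ (subpathVia-reverse (subpath-across-rays P ma (reverse⁺ y∈) x∈))

module Rooted {V : Set} {A : V → V → Set} (T : IsTree A) (r : V) where
  open Paths {A = A} (IsTree.sym T)

  _≤_ : V → V → Set
  _≤_ = TreeLe A r

  _<_ : V → V → Set
  a < b = a ≤ b × a ≢ b

  MinimalIn : List V → V → Set
  MinimalIn p μ = ∀ {c} → c ∈ p → ¬ c < μ

  -- The root path to μ meets p only in μ, so it extends along any subpath from μ.
  ≤-end-of-subpath-from-minimal : ∀ {p μ z q x} →
                                  MinimalIn p μ → Subpath p μ z q → x ∈ q → x ≤ z
  ≤-end-of-subpath-from-minimal {μ = μ} min (Q , q⊆p) x∈q =
    let R , PR = IsTree.path T r μ
        q′ , Q′ , q⊆q′ , _ = path-glue PR Q λ c∈R c∈q c≢μ →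
                               min (q⊆p c∈q) ((R , PR , c∈R) , c≢μ)
    in q′ , Q′ , q⊆q′ x∈q

  common-path-vertices-comparable : ∀ {u₁ w₁ p₁ u₂ w₂ p₂ μ₁ μ₂ x y} →
    IsPath A u₁ w₁ p₁ → IsPath A u₂ w₂ p₂ →
    μ₁ ∈ p₁ → MinimalIn p₁ μ₁ → MinimalIn p₂ μ₂ → μ₁ < μ₂ →
    x ∈ p₁ → x ∈ p₂ → y ∈ p₁ → y ∈ p₂ → x ≤ y ⊎ y ≤ x
  common-path-vertices-comparable P₁ P₂ μ₁∈p₁ min₁ min₂ μ₁<μ₂ x∈₁ x∈₂ y∈₁ y∈₂
    with subpath-between P₁ μ₁∈p₁ x∈₁ y∈₁
  ... | inj₂ (inj₁ (_ , Q , x∈q)) = inj₁ (≤-end-of-subpath-from-minimal min₁ Q x∈q)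
  ... | inj₂ (inj₂ (_ , Q , y∈q)) = inj₂ (≤-end-of-subpath-from-minimal min₁ Q y∈q)
  ... | inj₁ (_ , (Q , _) , μ₁∈q) =
    let _ , Q′ , q′⊆p₂ = subpath P₂ x∈₂ y∈₂
    in ⊥-elim (min₂ (q′⊆p₂ (subst (_ ∈_) (IsTree.unique T Q Q′) μ₁∈q)) μ₁<μ₂)

  common-vertices-comparable : ∀ {S₁ S₂ : V → Set} {μ₁ μ₂ x y} →
    IsPathVertexSet A S₁ → IsPathVertexSet A S₂ →
    S₁ μ₁ → (∀ {c} → S₁ c → ¬ c < μ₁) → (∀ {c} → S₂ c → ¬ c < μ₂) → μ₁ < μ₂ →
    S₁ x → S₂ x → S₁ y → S₂ y → x ≤ y ⊎ y ≤ x
  common-vertices-comparable (_ , _ , _ , P₁ , S₁⇔) (_ , _ , _ , P₂ , S₂⇔)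
                             μ₁∈ min₁ min₂ μ₁<μ₂ x∈₁ x∈₂ y∈₁ y∈₂ =
    common-path-vertices-comparable P₁ P₂ (to (S₁⇔ _) μ₁∈)
      (min₁ ∘ from (S₁⇔ _)) (min₂ ∘ from (S₂⇔ _)) μ₁<μ₂
      (to (S₁⇔ _) x∈₁) (to (S₂⇔ _) x∈₂) (to (S₁⇔ _) y∈₁) (to (S₂⇔ _) y∈₂)

open TreePathIntersectionGraph

lemma9 : ∀ {m n} (G : TreePathIntersectionGraph m n) (hr : Fin m) (vr : Fin n) →
         TreePathIntersectionGraph.E G hr vr →
         IsLeaf (TreePathIntersectionGraph.TV G) vr →
         ∀ (s₁ s₂ μ₁ μ₂ : Vtx m n) →
         IsMinimal G hr vr (TreePathIntersectionGraph.Γ G s₁) μ₁ →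
         IsMinimal G hr vr (TreePathIntersectionGraph.Γ G s₂) μ₂ →
         Lt G hr vr μ₁ μ₂ →
         ∀ (x y : Vtx m n) →
         TreePathIntersectionGraph.Γ G s₁ x → TreePathIntersectionGraph.Γ G s₂ x →
         TreePathIntersectionGraph.Γ G s₁ y → TreePathIntersectionGraph.Γ G s₂ y →
         Comparable G hr vr x y
lemma9 G hr vr _ _ (inj₁ h₁) (inj₁ h₂) (inj₂ μ₁) (inj₂ μ₂) (μ₁∈ , min₁) (_ , min₂) (μ₁≤μ₂ , μ₁≢μ₂)
       (inj₂ x) (inj₂ y) x∈₁ x∈₂ y∈₁ y∈₂ =
  Rooted.common-vertices-comparable (TV-tree G) vr (H-path G h₁) (H-path G h₂) μ₁∈
    (λ c∈ (c≤ , c≢) → min₁ _ c∈ (c≤ , c≢ ∘ inj₂-injective))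
    (λ c∈ (c≤ , c≢) → min₂ _ c∈ (c≤ , c≢ ∘ inj₂-injective))
    (μ₁≤μ₂ , μ₁≢μ₂ ∘ cong inj₂) x∈₁ x∈₂ y∈₁ y∈₂
lemma9 G hr vr _ _ (inj₂ v₁) (inj₂ v₂) (inj₁ μ₁) (inj₁ μ₂) (μ₁∈ , min₁) (_ , min₂) (μ₁≤μ₂ , μ₁≢μ₂)
       (inj₁ x) (inj₁ y) x∈₁ x∈₂ y∈₁ y∈₂ =
  Rooted.common-vertices-comparable (TH-tree G) hr (V-path G v₁) (V-path G v₂) μ₁∈
    (λ c∈ (c≤ , c≢) → min₁ _ c∈ (c≤ , c≢ ∘ inj₁-injective))
    (λ c∈ (c≤ , c≢) → min₂ _ c∈ (c≤ , c≢ ∘ inj₁-injective))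
    (μ₁≤μ₂ , μ₁≢μ₂ ∘ cong inj₁) x∈₁ x∈₂ y∈₁ y∈₂
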